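{- Let $(K,T,+,;,{}^*,\bar{\ },0,1)$ be a Kleene algebra with tests (KAT) and define $a\rightarrow b:=\bar{a}+b$ for $a,b\in T$. Then $(K,T,+,;,{}^*,\rightarrow,0,1)$ is an idempotent graded Kleene algebra with tests (I-GKAT). Moreover, every I-GKAT is a GKAT.
   Context: A Kleene algebra with tests (KAT) is a tuple $(K,T,+,;,{}^*,\bar{\ },0,1)$ with $T\subseteq K$, $0,1\in T$, such that $(K,+,;,{}^*,0,1)$ is a Kleene algebra (an idempotent semiring with $1+p;p^*\leq p^*$, $1+p^*;p\leq p^*$, $q+p;r\leq r\Rightarrow p^*;q\leq r$, $q+r;p\leq r\Rightarrow q;p^*\leq r$), $(T,+,;,\bar{\ },0,1)$ is a Boolean algebra (with $+$ as join, $;$ as meet, $\bar{\ }$ as complement), and $(T,+,;,0,1)$ is a subalgebra of $(K,+,;,0,1)$. A graded Kleene algebra with tests (GKAT) is a tuple $(K,T,+,;,{}^*,\rightarrow,0,1)$ where $K$ is a set, $T\subseteq K$, $0,1\in T$, $+$ and $;$ are binary operations on $K$ under which $T$ is closed, ${}^*$ is a unary operation on $K$, and $\rightarrow$ is a binary operation on $T$ with values in $T$, such that for all $p,q,r\in K$ and $a,b,c\in T$: $p+(q+r)=(p+q)+r$; $p+q=q+p$; $p;(q;r)=(p;q);r$; $p;1=1;p=p$; $p;(q+r)=p;q+p;r$; $(p+q);r=p;r+q;r$; $p;0=0;p=0$; $1+p;p^*=p^*$; $q+p;r\leq r\Rightarrow p^*;q\leq r$; $q+r;p\leq r\Rightarrow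 q;p^*\leq r$; $a;b\leq c\Leftrightarrow b\leq a\rightarrow c$; $a\leq 1$; $a;b=b;a$. Here $p\leq q$ means $p+q=q$. An idempotent GKAT (I-GKAT) is a GKAT that additionally satisfies $a;a=a$ for all $a\in T$. -}

module Defs where

open import Level using (Level; _⊔_; suc)
open import Data.Product using (Σ; _×_; _,_; proj₁; proj₂)
open import Function.Bundles using (_⇔_)
open import Relation.Binary.PropositionalEquality using (_≡_)
open import Algebra.Core using (Op₁; Op₂)
open import Algebra.Lattice.Structures using (IsBooleanAlgebra)

-- Equality of carriers is propositional equality.  The set of tests T ⊆ K is a
-- predicate on K; elements of T are pairs (a , proof that a ∈ T).

module _ {c : Level} {K : Set c} where

  _≤[_]_ : K → Op₂ K → K → Set c
  p ≤[ _+_ ] q = (p + q) ≡ q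

record IsKleeneAlgebra {c : Level} {K : Set c}
         (_+_ _︔_ : Op₂ K) (_* : Op₁ K) (𝟘 𝟙 : K) : Set c where
  infix 4 _≤_
  _≤_ : K → K → Set c
  p ≤ q = p ≤[ _+_ ] q
  field
    +-assoc    : ∀ p q r → (p + (q + r)) ≡ ((p + q) + r)
    +-comm     : ∀ p q → (p + q) ≡ (q + p)
    +-identityˡ : ∀ p → (𝟘 + p) ≡ p
    +-idem     : ∀ p → (p + p) ≡ p
    ︔-assoc    : ∀ p q r → (p ︔ (q ︔ r)) ≡ ((p ︔ q) ︔ r)
    ︔-identityʳ : ∀ p → (p ︔ 𝟙) ≡ p
    ︔-identityˡ : ∀ p → (𝟙 ︔ p) ≡ p
    distribˡ   : ∀ p q r → (p ︔ (q + r)) ≡ ((p ︔ q) + (p ︔ r))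
    distribʳ   : ∀ p q r → ((p + q) ︔ r) ≡ ((p ︔ r) + (q ︔ r))
    zeroʳ      : ∀ p → (p ︔ 𝟘) ≡ 𝟘
    zeroˡ      : ∀ p → (𝟘 ︔ p) ≡ 𝟘
    unfoldˡ    : ∀ p → (𝟙 + (p ︔ (p *))) ≤ (p *)
    unfoldʳ    : ∀ p → (𝟙 + ((p *) ︔ p)) ≤ (p *)
    inductionˡ : ∀ p q r → (q + (p ︔ r)) ≤ r → ((p *) ︔ q) ≤ r
    inductionʳ : ∀ p q r → (q + (r ︔ p)) ≤ r → (q ︔ (p *)) ≤ r

record KAT (c ℓ : Level) : Set (suc (c ⊔ ℓ)) where
  field
    K    : Set c
    T    : K → Set ℓ
    _+_  : Op₂ K
    _︔_  : Op₂ K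
    _*   : Op₁ K
    𝟘 𝟙  : K
    isKleeneAlgebra : IsKleeneAlgebra _+_ _︔_ _* 𝟘 𝟙
    𝟘∈T  : T 𝟘
    𝟙∈T  : T 𝟙
    +-closed : ∀ {a b} → T a → T b → T (a + b)
    ︔-closed : ∀ {a b} → T a → T b → T (a ︔ b)
    ‾    : Σ K T → Σ K T

  Test : Set (c ⊔ ℓ)
  Test = Σ K T

  _⊕_ : Op₂ Test
  x ⊕ y = (proj₁ x + proj₁ y) , +-closed (proj₂ x) (proj₂ y)

  _⊗_ : Op₂ Test
  x ⊗ y = (proj₁ x ︔ proj₁ y) , ︔-closed (proj₂ x) (proj₂ y)

  ⊥ₜ : Test
  ⊥ₜ = 𝟘 , 𝟘∈T

  ⊤ₜ : Test
  ⊤ₜ = 𝟙 , 𝟙∈T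

  _≈ₜ_ : Test → Test → Set c
  x ≈ₜ y = proj₁ x ≡ proj₁ y

  field
    isBooleanAlgebra : IsBooleanAlgebra _≈ₜ_ _⊕_ _⊗_ ‾ ⊤ₜ ⊥ₜ

  _⇒_ : Op₂ Test
  a ⇒ b = ‾ a ⊕ b

record IsGKAT {c ℓ : Level} {K : Set c} (T : K → Set ℓ)
         (_+_ _︔_ : Op₂ K) (_* : Op₁ K) (_⇒_ : Op₂ (Σ K T)) (𝟘 𝟙 : K)
         : Set (c ⊔ ℓ) where
  infix 4 _≤_
  _≤_ : K → K → Set c
  p ≤ q = p ≤[ _+_ ] q
  field
    𝟘∈T  : T 𝟘
    𝟙∈T  : T 𝟙
    +-closed : ∀ {a b} → T a → T b → T (a + b)
    ︔-closed : ∀ {a b} → T a → T b → T (a ︔ b)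
    +-assoc    : ∀ p q r → (p + (q + r)) ≡ ((p + q) + r)
    +-comm     : ∀ p q → (p + q) ≡ (q + p)
    ︔-assoc    : ∀ p q r → (p ︔ (q ︔ r)) ≡ ((p ︔ q) ︔ r)
    ︔-identityʳ : ∀ p → (p ︔ 𝟙) ≡ p
    ︔-identityˡ : ∀ p → (𝟙 ︔ p) ≡ p
    distribˡ   : ∀ p q r → (p ︔ (q + r)) ≡ ((p ︔ q) + (p ︔ r))
    distribʳ   : ∀ p q r → ((p + q) ︔ r) ≡ ((p ︔ r) + (q ︔ r))
    zeroʳ      : ∀ p → (p ︔ 𝟘) ≡ 𝟘
    zeroˡ      : ∀ p → (𝟘 ︔ p) ≡ 𝟘
    unfold     : ∀ p → (𝟙 + (p ︔ (p *))) ≡ (p *)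
    inductionˡ : ∀ p q r → (q + (p ︔ r)) ≤ r → ((p *) ︔ q) ≤ r
    inductionʳ : ∀ p q r → (q + (r ︔ p)) ≤ r → (q ︔ (p *)) ≤ r
    residuation : ∀ (a b c : Σ K T) →
                  ((proj₁ a ︔ proj₁ b) ≤ proj₁ c) ⇔ (proj₁ b ≤ proj₁ (a ⇒ c))
    test-≤𝟙    : ∀ (a : Σ K T) → proj₁ a ≤ 𝟙
    test-comm  : ∀ (a b : Σ K T) → (proj₁ a ︔ proj₁ b) ≡ (proj₁ b ︔ proj₁ a)

record IsIGKAT {c ℓ : Level} {K : Set c} (T : K → Set ℓ)
         (_+_ _︔_ : Op₂ K) (_* : Op₁ K) (_⇒_ : Op₂ (Σ K T)) (𝟘 𝟙 : K)
         : Set (c ⊔ ℓ) where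
  field
    isGKAT    : IsGKAT T _+_ _︔_ _* _⇒_ 𝟘 𝟙
    test-idem : ∀ (a : Σ K T) → (proj₁ a ︔ proj₁ a) ≡ proj₁ a

module Submission where

open import Defs
open import Level using (Level; _⊔_)
open import Data.Product using (Σ; _×_; _,_)
open import Algebra.Core using (Op₁; Op₂)
open import Algebra.Lattice.Bundles using (BooleanAlgebra)
open import Function.Bundles using (_⇔_; mk⇔)
open import Relation.Binary.PropositionalEquality using (_≡_; sym; trans; cong; subst; module ≡-Reasoning)

-- In a Boolean algebra, read with the order x ≤ y :⇔ x ∨ y ≈ y, meet with x is left
-- adjoint to x ⇒ z := ¬ x ∨ z.
module BooleanAlgebraResiduation {b ℓ} (B : BooleanAlgebra b ℓ) where
  open BooleanAlgebra B
  open import Algebra.Lattice.Properties.BooleanAlgebra B using (∧-identityˡ; ∨-identityˡ)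
  open import Relation.Binary.Reasoning.Setoid setoid

  x∧y∨¬x≈y∨¬x : ∀ x y → (x ∧ y) ∨ ¬ x ≈ y ∨ ¬ x
  x∧y∨¬x≈y∨¬x x y = begin
    (x ∧ y) ∨ ¬ x        ≈⟨ ∨-distribʳ-∧ (¬ x) x y ⟩
    (x ∨ ¬ x) ∧ (y ∨ ¬ x) ≈⟨ ∧-congʳ (∨-complementʳ x) ⟩
    ⊤ ∧ (y ∨ ¬ x)         ≈⟨ ∧-identityˡ (y ∨ ¬ x) ⟩
    y ∨ ¬ x               ∎

  x∧[¬x∨z]≈x∧z : ∀ x z → x ∧ (¬ x ∨ z) ≈ x ∧ z
  x∧[¬x∨z]≈x∧z x z = begin
    x ∧ (¬ x ∨ z)         ≈⟨ ∧-distribˡ-∨ x (¬ x) z ⟩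
    (x ∧ ¬ x) ∨ (x ∧ z)   ≈⟨ ∨-congʳ (∧-complementʳ x) ⟩
    ⊥ ∨ (x ∧ z)           ≈⟨ ∨-identityˡ (x ∧ z) ⟩
    x ∧ z                 ∎

  ∧-residuated : ∀ x y z → ((x ∧ y) ∨ z ≈ z) ⇔ (y ∨ (¬ x ∨ z) ≈ ¬ x ∨ z)
  ∧-residuated x y z = mk⇔ to from
    where
    to : (x ∧ y) ∨ z ≈ z → y ∨ (¬ x ∨ z) ≈ ¬ x ∨ z
    to x∧y≤z = begin
      y ∨ (¬ x ∨ z)           ≈⟨ ∨-assoc y (¬ x) z ⟨
      (y ∨ ¬ x) ∨ z           ≈⟨ ∨-congʳ (x∧y∨¬x≈y∨¬x x y) ⟨
      ((x ∧ y) ∨ ¬ x) ∨ z     ≈⟨ ∨-congʳ (∨-comm (x ∧ y) (¬ x)) ⟩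
      (¬ x ∨ (x ∧ y)) ∨ z     ≈⟨ ∨-assoc (¬ x) (x ∧ y) z ⟩
      ¬ x ∨ ((x ∧ y) ∨ z)     ≈⟨ ∨-congˡ x∧y≤z ⟩
      ¬ x ∨ z                 ∎

    from : y ∨ (¬ x ∨ z) ≈ ¬ x ∨ z → (x ∧ y) ∨ z ≈ z
    from y≤x⇒z = begin
      (x ∧ y) ∨ z                   ≈⟨ ∨-congˡ z≈x∧z∨z ⟩
      (x ∧ y) ∨ ((x ∧ z) ∨ z)       ≈⟨ ∨-assoc (x ∧ y) (x ∧ z) z ⟨
      ((x ∧ y) ∨ (x ∧ z)) ∨ z       ≈⟨ ∨-congʳ x∧y∨x∧z≈x∧z ⟩
      (x ∧ z) ∨ z                   ≈⟨ z≈x∧z∨z ⟨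
      z                             ∎
      where
      z≈x∧z∨z : z ≈ (x ∧ z) ∨ z
      z≈x∧z∨z = begin
        z               ≈⟨ ∨-absorbs-∧ z x ⟨
        z ∨ (z ∧ x)     ≈⟨ ∨-congˡ (∧-comm z x) ⟩
        z ∨ (x ∧ z)     ≈⟨ ∨-comm z (x ∧ z) ⟩
        (x ∧ z) ∨ z     ∎

      x∧y∨x∧z≈x∧z : (x ∧ y) ∨ (x ∧ z) ≈ x ∧ z
      x∧y∨x∧z≈x∧z = begin
        (x ∧ y) ∨ (x ∧ z)             ≈⟨ ∨-congˡ (x∧[¬x∨z]≈x∧z x z) ⟨
        (x ∧ y) ∨ (x ∧ (¬ x ∨ z))     ≈⟨ ∧-distribˡ-∨ x y (¬ x ∨ z) ⟨
        x ∧ (y ∨ (¬ x ∨ z))           ≈⟨ ∧-congˡ y≤x⇒z ⟩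
        x ∧ (¬ x ∨ z)                 ≈⟨ x∧[¬x∨z]≈x∧z x z ⟩
        x ∧ z                         ∎

module KleeneAlgebraProperties {c} {K : Set c} {_+_ _︔_ : Op₂ K} {_* : Op₁ K} {𝟘 𝟙 : K}
         (isKleeneAlgebra : IsKleeneAlgebra _+_ _︔_ _* 𝟘 𝟙) where
  open IsKleeneAlgebra isKleeneAlgebra
  open ≡-Reasoning

  ≤-antisym : ∀ {p q} → p ≤ q → q ≤ p → p ≡ q
  ≤-antisym {p} {q} p≤q q≤p = trans (sym q≤p) (trans (+-comm q p) p≤q)

  +-monoʳ-≤ : ∀ p {q r} → q ≤ r → (p + q) ≤ (p + r)
  +-monoʳ-≤ p {q} {r} q≤r = begin
    (p + q) + (p + r)   ≡⟨ +-assoc p q (p + r) ⟨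
    p + (q + (p + r))   ≡⟨ cong (p +_) (+-assoc q p r) ⟩
    p + ((q + p) + r)   ≡⟨ cong (λ s → p + (s + r)) (+-comm q p) ⟩
    p + ((p + q) + r)   ≡⟨ cong (p +_) (+-assoc p q r) ⟨
    p + (p + (q + r))   ≡⟨ cong (λ s → p + (p + s)) q≤r ⟩
    p + (p + r)         ≡⟨ +-assoc p p r ⟩
    (p + p) + r         ≡⟨ cong (_+ r) (+-idem p) ⟩
    p + r               ∎

  ︔-monoʳ-≤ : ∀ p {q r} → q ≤ r → (p ︔ q) ≤ (p ︔ r)
  ︔-monoʳ-≤ p {q} {r} q≤r = trans (sym (distribˡ p q r)) (cong (p ︔_) q≤r)

  -- The reverse inequality holds because 1 + p ; p* is itself closed under 1 + p ; _.
  *-unfold : ∀ p → (𝟙 + (p ︔ (p *))) ≡ (p *)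
  *-unfold p = ≤-antisym (unfoldˡ p) p*≤1+p︔p*
    where
    r : K
    r = 𝟙 + (p ︔ (p *))

    p*≤1+p︔p* : (p *) ≤ r
    p*≤1+p︔p* = subst (_≤ r) (︔-identityʳ (p *))
                   (inductionˡ p 𝟙 r (+-monoʳ-≤ 𝟙 (︔-monoʳ-≤ p (unfoldˡ p))))

module KATProperties {c ℓ} (A : KAT c ℓ) where
  open KAT A
  open IsKleeneAlgebra isKleeneAlgebra using (+-assoc; +-comm; ︔-assoc; ︔-identityʳ; ︔-identityˡ;
    distribˡ; distribʳ; zeroʳ; zeroˡ; inductionˡ; inductionʳ)
  open KleeneAlgebraProperties isKleeneAlgebra using (*-unfold)

  testAlgebra : BooleanAlgebra (c ⊔ ℓ) c
  testAlgebra = record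
    { Carrier = Test ; _≈_ = _≈ₜ_ ; _∨_ = _⊕_ ; _∧_ = _⊗_ ; ¬_ = ‾ ; ⊤ = ⊤ₜ ; ⊥ = ⊥ₜ
    ; isBooleanAlgebra = isBooleanAlgebra }

  open BooleanAlgebra testAlgebra using (∧-comm)
  open import Algebra.Lattice.Properties.BooleanAlgebra testAlgebra using (∧-idem; ∨-zeroʳ)
  open BooleanAlgebraResiduation testAlgebra using (∧-residuated)

  isIGKAT : IsIGKAT T _+_ _︔_ _* _⇒_ 𝟘 𝟙
  isIGKAT = record
    { isGKAT = record
      { 𝟘∈T = 𝟘∈T ; 𝟙∈T = 𝟙∈T ; +-closed = +-closed ; ︔-closed = ︔-closed
      ; +-assoc = +-assoc ; +-comm = +-comm ; ︔-assoc = ︔-assoc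
      ; ︔-identityʳ = ︔-identityʳ ; ︔-identityˡ = ︔-identityˡ
      ; distribˡ = distribˡ ; distribʳ = distribʳ ; zeroʳ = zeroʳ ; zeroˡ = zeroˡ
      ; unfold = *-unfold ; inductionˡ = inductionˡ ; inductionʳ = inductionʳ
      ; residuation = ∧-residuated ; test-≤𝟙 = ∨-zeroʳ ; test-comm = ∧-comm }
    ; test-idem = ∧-idem }

lemma2 : (c ℓ : Level) →
         ((A : KAT c ℓ) →
            IsIGKAT (KAT.T A) (KAT._+_ A) (KAT._︔_ A) (KAT._* A) (KAT._⇒_ A) (KAT.𝟘 A) (KAT.𝟙 A))
       × ({K : Set c} → (T : K → Set ℓ) → (_+_ _︔_ : Op₂ K) → (_* : Op₁ K) →
            (_⇒_ : Op₂ (Σ K T)) → (𝟘 𝟙 : K) →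
            IsIGKAT T _+_ _︔_ _* _⇒_ 𝟘 𝟙 → IsGKAT T _+_ _︔_ _* _⇒_ 𝟘 𝟙)
lemma2 c ℓ = KATProperties.isIGKAT , λ T _+_ _︔_ _* _⇒_ 𝟘 𝟙 → IsIGKAT.isGKAT
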